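{- Let $b\ge2$ be an integer. For $n\ge0$ let $S_n=[(n)_b1]_{2b-1}$, i.e. if $n=\sum_{i=1}^k n_ib^{i-1}$ with $n_i\in\{0,\dots,b-1\}$ then $S_n=\sum_{i=1}^k n_i(2b-1)^i+1$ (so $S_0=1$). Then the set $S=\{S_n:n\ge0\}$ is sum-free, and $S$ is a $(2b-1)$-automatic set, i.e. its characteristic sequence $(a_n)_{n\ge0}$ ($a_n=1$ if $n\in S$, $a_n=0$ otherwise) is $(2b-1)$-automatic.
   Context: A set $S$ of positive integers is sum-free if there are no $x,y,z\in S$ ($x,y$ not necessarily distinct) with $x+y=z$. $(n)_b$ is the base-$b$ expansion of $n$ (empty for $n=0$), $w1$ denotes appending the digit $1$, and $[w]_{q}$ is the integer whose base-$q$ digit string is $w$. A sequence is $q$-automatic if it is generated by a deterministic finite automaton with output reading the base-$q$ digits of $n$. -}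

module Defs where

open import Data.Nat using (ℕ; zero; suc; _+_; _*_; _∸_; _^_; _≤_; NonZero)
open import Data.Nat.DivMod using (_/_; _%_; m%n<n)
open import Data.Fin using (Fin; fromℕ<)
open import Data.List using (List; []; _∷_; reverse; foldl)
open import Data.Bool using (Bool; true; false)
open import Data.Product using (Σ; ∃; _×_; _,_)
open import Relation.Binary.PropositionalEquality using (_≡_)

-- Base-b digits of n, least significant first, as naturals.
-- Uses fuel (n itself suffices since n/b < n for n > 0, b ≥ 2).
-- (n)_b is empty for n = 0.
digitsAux : (b : ℕ) .{{_ : NonZero b}} → ℕ → ℕ → List ℕ
digitsAux b zero    n       = []
digitsAux b (suc f) zero    = []
digitsAux b (suc f) (suc n) = (suc n % b) ∷ digitsAux b f (suc n / b)

digitsLSD : (b : ℕ) .{{_ : NonZero b}} → ℕ → List ℕ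
digitsLSD b n = digitsAux b n n

digitsFinAux : (b : ℕ) .{{_ : NonZero b}} → ℕ → ℕ → List (Fin b)
digitsFinAux b zero    n       = []
digitsFinAux b (suc f) zero    = []
digitsFinAux b (suc f) (suc n) = fromℕ< (m%n<n (suc n) b) ∷ digitsFinAux b f (suc n / b)

baseDigits : (b : ℕ) .{{_ : NonZero b}} → ℕ → List (Fin b)
baseDigits b n = reverse (digitsFinAux b n n)

weightedSum : ℕ → ℕ → List ℕ → ℕ
weightedSum q i []       = 0
weightedSum q i (d ∷ ds) = d * q ^ i + weightedSum q (suc i) ds

S : (b : ℕ) .{{_ : NonZero b}} → ℕ → ℕ
S b n = weightedSum (2 * b ∸ 1) 1 (digitsLSD b n) + 1

InS : (b : ℕ) .{{_ : NonZero b}} → ℕ → Set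
InS b m = ∃ λ n → S b n ≡ m

SumFree : (ℕ → Set) → Set
SumFree T = ∀ x y z → T x → T y → T z → x + y ≡ z → Data.Empty.⊥
  where import Data.Empty

record DFAO (q : ℕ) (A : Set) : Set where
  field
    m     : ℕ
    start : Fin m
    δ     : Fin m → Fin q → Fin m
    out   : Fin m → A

runDFAO : ∀ {q A} → (M : DFAO q A) → List (Fin q) → A
runDFAO {q} M w = DFAO.out M (foldl (DFAO.δ M) (DFAO.start M) w)

Automatic : (q : ℕ) .{{_ : NonZero q}} → {A : Set} → (ℕ → A) → Set
Automatic q {A} a = Σ (DFAO q A) λ M → ∀ n → runDFAO M (baseDigits q n) ≡ a n

IsCharSeq : (ℕ → Set) → (ℕ → Bool) → Set
IsCharSeq T a = ∀ n → (a n ≡ true → T n) × (T n → a n ≡ true)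

{-# OPTIONS --safe #-}
-- Write q = 2b − 1.  Every S_n is 1 + q·W where W is the base-q value of a word whose digits are
-- all < b, so every element is ≡ 1 (mod q) while a sum of two elements is ≡ 2 (mod q); as q ≥ 3
-- the set is sum-free.  Conversely, since digits < b ≤ q are valid base-q digits, m ∈ S exactly
-- when the base-q expansion of m ends in the digit 1 and has all other digits < b, a regular
-- language recognised by a three-state automaton.
module Submission where

open import Defs
open import Data.Nat using (ℕ; zero; suc; _+_; _*_; _∸_; _^_; _≤_; _<_; z≤n; s≤s; NonZero; _<?_; _≟_)
open import Data.Nat.Properties
open import Data.Nat.DivMod
open import Data.Nat.Divisibility using (m∣m*n)
open import Data.Fin using (Fin; toℕ)
open import Data.Fin.Properties using (toℕ-fromℕ<)
open import Data.List using (List; []; _∷_; reverse; foldr; map)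
open import Data.List.Properties using (reverse-foldl)
open import Data.List.Relation.Unary.All as All using (All; []; _∷_)
open import Data.List.Relation.Unary.All.Properties using (map⁺; map⁻)
open import Data.Bool using (Bool; true; false)
open import Data.Product using (Σ; ∃-syntax; _×_; _,_)
open import Data.Empty using (⊥; ⊥-elim)
open import Function using (flip)
open import Function.Bundles using (_⇔_; mk⇔; Equivalence)
open import Function.Properties.Equivalence using () renaming (sym to ⇔-sym; trans to ⇔-trans)
open import Relation.Nullary using (yes; no)
open import Relation.Binary.PropositionalEquality
open import Data.Nat.Solver using (module +-*-Solver)
open +-*-Solver using (solve; _:+_; _:*_; _:=_)

fromDigits : ℕ → List ℕ → ℕ
fromDigits q []       = 0
fromDigits q (d ∷ ds) = d + q * fromDigits q ds

weightedSum≡^*fromDigits : ∀ q i ds → weightedSum q i ds ≡ q ^ i * fromDigits q ds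
weightedSum≡^*fromDigits q i []       = sym (*-zeroʳ (q ^ i))
weightedSum≡^*fromDigits q i (d ∷ ds) rewrite weightedSum≡^*fromDigits q (suc i) ds =
  solve 4 (λ d x q v → d :* x :+ (q :* x) :* v := x :* (d :+ q :* v)) refl d (q ^ i) q (fromDigits q ds)

module _ (b : ℕ) .{{_ : NonZero b}} where

  [d+b*v]%b≡d : ∀ d v → d < b → (d + b * v) % b ≡ d
  [d+b*v]%b≡d d v d<b = begin
    (d + b * v) % b ≡⟨ %-remove-+ʳ d (m∣m*n v) ⟩
    d % b           ≡⟨ m<n⇒m%n≡m d<b ⟩
    d               ∎
    where open ≡-Reasoning

  [d+b*v]/b≡v : ∀ d v → d < b → (d + b * v) / b ≡ v
  [d+b*v]/b≡v d v d<b = begin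
    (d + b * v) / b   ≡⟨ +-distrib-/-∣ʳ d (m∣m*n v) ⟩
    d / b + b * v / b ≡⟨ cong₂ _+_ (m<n⇒m/n≡0 d<b) (trans (/-congˡ (*-comm b v)) (m*n/n≡m v b)) ⟩
    v                 ∎
    where open ≡-Reasoning

  digitsFinAux-toℕ : ∀ f n → map toℕ (digitsFinAux b f n) ≡ digitsAux b f n
  digitsFinAux-toℕ zero    n       = refl
  digitsFinAux-toℕ (suc f) zero    = refl
  digitsFinAux-toℕ (suc f) (suc n) =
    cong₂ _∷_ (toℕ-fromℕ< (m%n<n (suc n) b)) (digitsFinAux-toℕ f (suc n / b))

  digitsAux-< : ∀ f n → All (_< b) (digitsAux b f n)
  digitsAux-< zero    n       = []
  digitsAux-< (suc f) zero    = []
  digitsAux-< (suc f) (suc n) = m%n<n (suc n) b ∷ digitsAux-< f (suc n / b)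

  fromDigits≡0 : ∀ c E → fromDigits b E ≡ 0 → fromDigits c E ≡ 0
  fromDigits≡0 c []      _  = refl
  fromDigits≡0 c (e ∷ E) eq
    rewrite m+n≡0⇒m≡0 e eq
          | fromDigits≡0 c E (m*n≡0⇒m≡0 _ b (trans (*-comm _ b) (m+n≡0⇒n≡0 e eq))) = *-zeroʳ c

  digitsAux-fromDigits-All : ∀ {p} {P : ℕ → Set p} E f n → All (_< b) E → All P E →
                             n ≡ fromDigits b E → All P (digitsAux b f n)
  digitsAux-fromDigits-All E       zero    n       _        _        _  = []
  digitsAux-fromDigits-All E       (suc f) zero    _        _        _  = []
  digitsAux-fromDigits-All []      (suc f) (suc n) _        _        ()
  digitsAux-fromDigits-All (e ∷ E) (suc f) (suc n) (e<b ∷ E<b) (Pe ∷ PE) eq =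
    subst _ (sym (trans (cong (_% b) eq) ([d+b*v]%b≡d e _ e<b))) Pe
    ∷ digitsAux-fromDigits-All E f (suc n / b) E<b PE (trans (cong (_/ b) eq) ([d+b*v]/b≡v e _ e<b))

  module _ (1<b : 1 < b) where

    private
      quotient-fuel : ∀ {f} n → n ≤ f → suc n / b ≤ f
      quotient-fuel n n≤f = ≤-trans (<⇒≤pred (m/n<m (suc n) b 1<b)) n≤f

    fromDigits-digitsAux : ∀ f n → n ≤ f → fromDigits b (digitsAux b f n) ≡ n
    fromDigits-digitsAux zero    zero    _         = refl
    fromDigits-digitsAux (suc f) zero    _         = refl
    fromDigits-digitsAux (suc f) (suc n) (s≤s n≤f) = begin
      suc n % b + b * fromDigits b (digitsAux b f (suc n / b))
        ≡⟨ cong (λ v → suc n % b + b * v) (fromDigits-digitsAux f (suc n / b) (quotient-fuel n n≤f)) ⟩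
      suc n % b + b * (suc n / b) ≡⟨ cong (suc n % b +_) (*-comm b (suc n / b)) ⟩
      suc n % b + suc n / b * b   ≡⟨ sym (m≡m%n+[m/n]*n (suc n) b) ⟩
      suc n                       ∎
      where open ≡-Reasoning

    -- The base-b expansion of [E]_b differs from E only by trailing zeros.
    fromDigits-digitsAux-fromDigits : ∀ c E f n → All (_< b) E → n ≡ fromDigits b E → n ≤ f →
                                      fromDigits c (digitsAux b f n) ≡ fromDigits c E
    fromDigits-digitsAux-fromDigits c E       zero    zero    _           eq _ = sym (fromDigits≡0 c E (sym eq))
    fromDigits-digitsAux-fromDigits c E       (suc f) zero    _           eq _ = sym (fromDigits≡0 c E (sym eq))
    fromDigits-digitsAux-fromDigits c E       zero    (suc n) _           _  ()
    fromDigits-digitsAux-fromDigits c []      (suc f) (suc n) _           () _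
    fromDigits-digitsAux-fromDigits c (e ∷ E) (suc f) (suc n) (e<b ∷ E<b) eq (s≤s n≤f) =
      cong₂ (λ d v → d + c * v)
        (trans (cong (_% b) eq) ([d+b*v]%b≡d e _ e<b))
        (fromDigits-digitsAux-fromDigits c E f (suc n / b) E<b
          (trans (cong (_/ b) eq) ([d+b*v]/b≡v e _ e<b)) (quotient-fuel n n≤f))

sumFree-if-≡1-mod : ∀ q .{{_ : NonZero q}} {T : ℕ → Set} → 2 < q → (∀ x → T x → x % q ≡ 1) → SumFree T
sumFree-if-≡1-mod q 2<q ≡1 x y z Tx Ty Tz x+y≡z = 2≢1 (begin
  2                       ≡⟨ sym (m<n⇒m%n≡m 2<q) ⟩
  (1 + 1) % q             ≡⟨ cong₂ (λ u v → (u + v) % q) (sym (≡1 x Tx)) (sym (≡1 y Ty)) ⟩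
  (x % q + y % q) % q     ≡⟨ sym (%-distribˡ-+ x y q) ⟩
  (x + y) % q             ≡⟨ cong (_% q) x+y≡z ⟩
  z % q                   ≡⟨ ≡1 z Tz ⟩
  1                       ∎)
  where
    open ≡-Reasoning
    2≢1 : 2 ≡ 1 → ⊥
    2≢1 ()

-- Words are given least significant digit first, so this is the language of words ending in the
-- digit 1 whose other digits are < b; the automaton reads the reversed word.
OneThenBelow : ℕ → List ℕ → Set
OneThenBelow b []       = ⊥
OneThenBelow b (d ∷ ds) = d ≡ 1 × All (_< b) ds

OneThenBelow⇒fromDigits : ∀ q b L → OneThenBelow b L → ∃[ E ] All (_< b) E × fromDigits q L ≡ suc (q * fromDigits q E)
OneThenBelow⇒fromDigits q b (d ∷ ds) (refl , ds<b) = ds , ds<b , refl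

-- The state is dead once a digit ≥ b has been read, and otherwise records whether the last
-- digit read was 1.
pattern low  = Fin.zero
pattern one  = Fin.suc Fin.zero
pattern dead = Fin.suc (Fin.suc Fin.zero)

module _ (q b : ℕ) where

  digitState : ℕ → Fin 3
  digitState x with x <? b
  ... | no _  = dead
  ... | yes _ with x ≟ 1
  ...   | yes _ = one
  ...   | no _  = low

  transition : Fin 3 → Fin q → Fin 3
  transition low  d = digitState (toℕ d)
  transition one  d = digitState (toℕ d)
  transition dead _ = dead

  isOne : Fin 3 → Bool
  isOne one = true
  isOne _   = false

  oneThenBelowDFAO : DFAO q Bool
  oneThenBelowDFAO = record { m = 3 ; start = low ; δ = transition ; out = isOne }

  stateAfter : List (Fin q) → Fin 3
  stateAfter = foldr (flip transition) low

  runDFAO-reverse : ∀ L → runDFAO oneThenBelowDFAO (reverse L) ≡ isOne (stateAfter L)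
  runDFAO-reverse L = cong isOne (reverse-foldl transition low L)

  digitState-alive : ∀ {x} → x < b → digitState x ≢ dead
  digitState-alive {x} x<b with x <? b
  ... | no x≮b = ⊥-elim (x≮b x<b)
  ... | yes _ with x ≟ 1
  ...   | yes _ = λ ()
  ...   | no _  = λ ()

  digitState-alive⁻¹ : ∀ {x} → digitState x ≢ dead → x < b
  digitState-alive⁻¹ {x} alive with x <? b
  ... | no _    = ⊥-elim (alive refl)
  ... | yes x<b = x<b

  digitState≡one⇒≡1 : ∀ {x} → digitState x ≡ one → x ≡ 1
  digitState≡one⇒≡1 {x} eq with x <? b
  digitState≡one⇒≡1 () | no _
  ... | yes _ with x ≟ 1
  ...   | yes x≡1 = x≡1
  digitState≡one⇒≡1 () | yes _ | no _

  digitState-1 : 1 < b → digitState 1 ≡ one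
  digitState-1 1<b with 1 <? b
  ... | no 1≮b = ⊥-elim (1≮b 1<b)
  ... | yes _  = refl

  transition-alive : ∀ {s} d → s ≢ dead → transition s d ≡ digitState (toℕ d)
  transition-alive {low}  d _     = refl
  transition-alive {one}  d _     = refl
  transition-alive {dead} d alive = ⊥-elim (alive refl)

  stateAfter-alive : ∀ L → All (λ d → toℕ d < b) L → stateAfter L ≢ dead
  stateAfter-alive []       []          = λ ()
  stateAfter-alive (d ∷ ds) (d<b ∷ ds<b) rewrite transition-alive d (stateAfter-alive ds ds<b) =
    digitState-alive d<b

  stateAfter-tail-alive : ∀ d ds → stateAfter (d ∷ ds) ≢ dead → stateAfter ds ≢ dead
  stateAfter-tail-alive d ds alive e = alive (cong (flip transition d) e)

  stateAfter-alive⁻¹ : ∀ L → stateAfter L ≢ dead → All (λ d → toℕ d < b) L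
  stateAfter-alive⁻¹ []       _     = []
  stateAfter-alive⁻¹ (d ∷ ds) alive =
    digitState-alive⁻¹ (λ e → alive (trans (transition-alive d ds-alive) e)) ∷ stateAfter-alive⁻¹ ds ds-alive
    where
      ds-alive : stateAfter ds ≢ dead
      ds-alive = stateAfter-tail-alive d ds alive

  isOne≡true⇒≡one : ∀ {s} → isOne s ≡ true → s ≡ one
  isOne≡true⇒≡one {one} _ = refl

  accepts⇔OneThenBelow : 1 < b → ∀ L → isOne (stateAfter L) ≡ true ⇔ OneThenBelow b (map toℕ L)
  accepts⇔OneThenBelow 1<b L = mk⇔ (accepted L) (accepts L)
    where
      accepted : ∀ L → isOne (stateAfter L) ≡ true → OneThenBelow b (map toℕ L)
      accepted (d ∷ ds) acc =
        digitState≡one⇒≡1 (trans (sym (transition-alive d ds-alive)) (isOne≡true⇒≡one acc))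
        , map⁺ (stateAfter-alive⁻¹ ds ds-alive)
        where
          ds-alive : stateAfter ds ≢ dead
          ds-alive = stateAfter-tail-alive d ds (λ e → one≢dead (trans (sym (isOne≡true⇒≡one acc)) e))
            where
              one≢dead : one ≢ dead
              one≢dead ()

      accepts : ∀ L → OneThenBelow b (map toℕ L) → isOne (stateAfter L) ≡ true
      accepts (d ∷ ds) (d≡1 , ds<b) = begin
        isOne (transition (stateAfter ds) d) ≡⟨ cong isOne (transition-alive d (stateAfter-alive ds (map⁻ ds<b))) ⟩
        isOne (digitState (toℕ d))           ≡⟨ cong (λ x → isOne (digitState x)) d≡1 ⟩
        isOne (digitState 1)                 ≡⟨ cong isOne (digitState-1 1<b) ⟩
        true                                 ∎
        where open ≡-Reasoning

module _ (k : ℕ) where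

  private
    b q : ℕ
    b = suc (suc k)
    q = 2 * b ∸ 1

    1<b : 1 < b
    1<b = s≤s (s≤s z≤n)

    b≤q : b ≤ q
    b≤q = subst (λ x → b ≤ suc k + x) (sym (+-identityʳ b)) (m≤n+m b (suc k))

    2<q : 2 < q
    2<q = s≤s (≤-trans (s≤s (s≤s z≤n)) (m≤n+m (b + 0) k))

    1<q : 1 < q
    1<q = <-trans (s≤s (s≤s z≤n)) 2<q

  S≡suc[q*fromDigits] : ∀ n → S b n ≡ suc (q * fromDigits q (digitsLSD b n))
  S≡suc[q*fromDigits] n = begin
    weightedSum q 1 (digitsLSD b n) + 1      ≡⟨ cong (_+ 1) (weightedSum≡^*fromDigits q 1 (digitsLSD b n)) ⟩
    q ^ 1 * fromDigits q (digitsLSD b n) + 1 ≡⟨ cong (λ x → x * fromDigits q (digitsLSD b n) + 1) (*-identityʳ q) ⟩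
    q * fromDigits q (digitsLSD b n) + 1     ≡⟨ +-comm _ 1 ⟩
    suc (q * fromDigits q (digitsLSD b n))   ∎
    where open ≡-Reasoning

  InS⇔suc[q*fromDigits] : ∀ m → InS b m ⇔ (∃[ E ] All (_< b) E × m ≡ suc (q * fromDigits q E))
  InS⇔suc[q*fromDigits] m = mk⇔ to from
    where
      to : InS b m → ∃[ E ] All (_< b) E × m ≡ suc (q * fromDigits q E)
      to (n , refl) = digitsLSD b n , digitsAux-< b n n , S≡suc[q*fromDigits] n

      from : ∃[ E ] All (_< b) E × m ≡ suc (q * fromDigits q E) → InS b m
      from (E , E<b , refl) = fromDigits b E , trans (S≡suc[q*fromDigits] (fromDigits b E))
        (cong (λ v → suc (q * v)) (fromDigits-digitsAux-fromDigits b 1<b q E _ _ E<b refl ≤-refl))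

  InS⇒%≡1 : ∀ m → InS b m → m % q ≡ 1
  InS⇒%≡1 m m∈S with Equivalence.to (InS⇔suc[q*fromDigits] m) m∈S
  ... | E , _ , refl = [d+b*v]%b≡d q 1 (fromDigits q E) 1<q

  InS⇔OneThenBelow : ∀ m → InS b m ⇔ OneThenBelow b (digitsAux q m m)
  InS⇔OneThenBelow m = mk⇔ to from
    where
      to : InS b m → OneThenBelow b (digitsAux q m m)
      to m∈S with Equivalence.to (InS⇔suc[q*fromDigits] m) m∈S
      ... | E , E<b , refl =
        [d+b*v]%b≡d q 1 W 1<q ,
        digitsAux-fromDigits-All q E (q * W) _ (All.map (λ e<b → ≤-trans e<b b≤q) E<b) E<b ([d+b*v]/b≡v q 1 W 1<q)
        where W = fromDigits q E

      from : OneThenBelow b (digitsAux q m m) → InS b m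
      from pat with OneThenBelow⇒fromDigits q b _ pat
      ... | E , E<b , eq = Equivalence.from (InS⇔suc[q*fromDigits] m)
        (E , E<b , trans (sym (fromDigits-digitsAux q 1<q m m ≤-refl)) eq)

  accepts⇔InS : ∀ n → runDFAO (oneThenBelowDFAO q b) (baseDigits q n) ≡ true ⇔ InS b n
  accepts⇔InS n rewrite runDFAO-reverse q b (digitsFinAux q n n) =
    ⇔-trans (accepts⇔OneThenBelow q b 1<b (digitsFinAux q n n))
      (subst (λ w → OneThenBelow b w ⇔ InS b n) (sym (digitsFinAux-toℕ q n n)) (⇔-sym (InS⇔OneThenBelow n)))

  S-sumFree : SumFree (InS b)
  S-sumFree = sumFree-if-≡1-mod q 2<q InS⇒%≡1

  S-charSeq : IsCharSeq (InS b) (λ n → runDFAO (oneThenBelowDFAO q b) (baseDigits q n))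
  S-charSeq n = Equivalence.to (accepts⇔InS n) , Equivalence.from (accepts⇔InS n)

mainTheorem11 : (k : ℕ) → let b = suc (suc k) in
    SumFree (InS b) ×
    Σ (ℕ → Bool) (λ a → IsCharSeq (InS b) a × Automatic (2 * b ∸ 1) a)
mainTheorem11 k = S-sumFree k , _ , S-charSeq k , oneThenBelowDFAO _ _ , λ n → refl
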